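{- Let $t$ and $k\ge 2$ be positive integers. If $H$ is a finite set of $k$-wise intersecting $t$-intervals, then there is a subset $F\subseteq H$ with $|F|\ge \frac{(k-1)|H|}{k+1}$ that is weakly intersecting.
   Context: Let $R_1,\dots,R_t$ be disjoint parallel lines in the plane. A $t$-interval is a set of the form $I_1\cup\dots\cup I_t$ where each $I_j$ is a closed interval contained in $R_j$. A family of $t$-intervals is $k$-wise intersecting if any $k$ members of it (not necessarily distinct) have a common point. A family of $t$-intervals is weakly intersecting if there is a set $P$ of points containing at most one point from each line $R_i$ such that every member of the family contains a point of $P$.
   Formalization: Points on the lines $R_j$ have rational coordinates, so the endpoints of the intervals $I_j$ and the points of $P$ are rational. -}

module Defs where

open import Data.Nat using (ℕ)
open import Data.Fin using (Fin)
open import Data.Vec using (Vec; lookup)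
open import Data.Product using (Σ; ∃; _×_; proj₁; proj₂)
open import Data.Maybe using (Maybe; just)
open import Data.List using (List)
open import Data.List.Membership.Propositional using (_∈_)
open import Data.Rational using (ℚ; _≤_)
open import Relation.Binary.PropositionalEquality using (_≡_)

Interval : Set
Interval = ℚ × ℚ

_∈I_ : ℚ → Interval → Set
x ∈I I = proj₁ I ≤ x × x ≤ proj₂ I

WellFormedI : Interval → Set
WellFormedI I = proj₁ I ≤ proj₂ I

-- A t-interval: one closed interval on each of the lines R_0 , … , R_{t-1}
TInterval : ℕ → Set
TInterval t = Vec Interval t

WellFormed : {t : ℕ} → TInterval t → Set
WellFormed {t} h = (j : Fin t) → WellFormedI (lookup h j)

-- A point of the plane lying on one of the lines: (index of the line , coordinate)
Point : ℕ → Set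
Point t = Σ (Fin t) (λ _ → ℚ)

_∈T_ : {t : ℕ} → Point t → TInterval t → Set
p ∈T h = proj₂ p ∈I lookup h (proj₁ p)

-- any k members (not necessarily distinct) of H have a common point
KWiseIntersecting : {t : ℕ} → ℕ → List (TInterval t) → Set
KWiseIntersecting {t} k H =
  (f : Fin k → TInterval t) → ((i : Fin k) → f i ∈ H) →
  ∃ (λ (p : Point t) → (i : Fin k) → p ∈T f i)

-- a set P with at most one point on each line, given as a partial choice
-- Fin t → Maybe ℚ, such that every member contains a point of P
WeaklyIntersecting : {t : ℕ} → List (TInterval t) → Set
WeaklyIntersecting {t} F =
  ∃ (λ (P : Fin t → Maybe ℚ) →
    (h : TInterval t) → h ∈ F →
    ∃ (λ (j : Fin t) → ∃ (λ (x : ℚ) → P j ≡ just x × x ∈I lookup h j)))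

-- Draw an arc i → j between members of H when h_j contains none of the left endpoints of h_i.
-- If two members containing a common point (l , y) are joined by an arc, the left endpoint on
-- line l strictly increases along it; the members of a closed walk of length at most k share a
-- point by k-wise intersection, so this digraph has girth greater than k.  Let u be a vertex of
-- minimum out-degree d.  The |H| - d members containing a left endpoint of h_u are weakly
-- intersecting, witnessed by the left endpoints of h_u, and for d > 0 the Chvátal–Szemerédi
-- bound (d + 1)(k + 1) ≤ 2|H| makes them numerous enough.  That bound is proved by induction on
-- the girth in steps of two: double counting gives a vertex of in-degree at least d, and
-- contracting it together with its in-neighbours removes at least d + 1 vertices.
module Submission where

open import Defs
open import Data.Nat.Properties
  using ( +-*-semiring; module ≤-Reasoning; ≤-refl; ≤-reflexive; ≤-trans; <⇒≱; ≰⇒>; >⇒≢; n<1+n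
        ; m≤m+n; m≤n+m; +-comm; +-identityʳ; +-mono-≤; +-monoˡ-≤; +-monoʳ-≤; +-cancelʳ-≤
        ; *-comm; *-identityʳ; *-zeroʳ; *-distribˡ-+; *-distribʳ-+; *-monoˡ-≤; *-monoʳ-≤; *-monoˡ-< )
open import Algebra.Properties.Semiring.Sum +-*-semiring
  using (sum; ∑-comm; ∑-distrib-+; *-distribˡ-sum; sum-cong-≗)
open import Data.Bool using (if_then_else_)
open import Data.Fin using (Fin; zero; suc; toℕ; fromℕ<; _≟_)
open import Data.Fin.Properties using (any?; toℕ-fromℕ<)
open import Data.List using (List; []; _∷_; length; filter; allFin)
import Data.List as List
open import Data.List.Extrema.Nat using (argmin; f[argmin]≤f[xs])
open import Data.List.Membership.Propositional.Properties using (∈-lookup; ∈-filter⁻; ∈-allFin)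
open import Data.List.Relation.Binary.Sublist.Propositional using (_⊆_; [])
open import Data.List.Relation.Binary.Sublist.Propositional.Properties using (filter-⊆)
open import Data.List.Relation.Unary.All as All using (All)
open import Data.List.Relation.Unary.Unique.Propositional using (Unique)
open import Data.Maybe using (just; nothing)
open import Data.Nat using (ℕ; zero; suc; _+_; _*_; _∸_; _≤_; _<_; _≤?_; z≤n; s≤s; s≤s⁻¹; >-nonZero)
open import Data.Nat.Tactic.RingSolver using (solve-∀)
open import Data.Product using (∃; _×_; _,_; proj₁; proj₂)
open import Data.Rational using (ℚ)
import Data.Rational as ℚ using (_<_)
import Data.Rational.Properties as ℚ
open import Data.Sum using (_⊎_; inj₁; inj₂)
open import Data.Unit using (tt)
open import Data.Vec using (lookup)
open import Function using (_∘_)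
open import Level using (0ℓ)
open import Relation.Binary using (Rel; Transitive) renaming (Decidable to Decidable₂)
open import Relation.Binary.PropositionalEquality using (_≡_; refl; sym; trans; cong; subst; subst₂)
open import Relation.Nullary using (Dec; does; yes; no; ¬_; contradiction)
open import Relation.Nullary.Decidable using (_×-dec_; _⊎-dec_; ¬?; toSum)
open import Relation.Unary using (Pred; Decidable; Satisfiable; U; ｛_｝; _∪_; _∩_; ∁; _⊥_)
  renaming (_⊆_ to _⊆ₚ_)
open import Relation.Unary.Properties using (_∪?_; _∩?_; ∁?)

indicator : {A : Set} → Dec A → ℕ
indicator d = if does d then 1 else 0

indicator-mono : {A B : Set} (a : Dec A) (b : Dec B) → (A → B) → indicator a ≤ indicator b
indicator-mono (no _)  _       _ = z≤n
indicator-mono (yes _) (yes _) _ = ≤-refl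
indicator-mono (yes a) (no ¬b) f = contradiction (f a) ¬b

count : ∀ {n} {P : Pred (Fin n) 0ℓ} → Decidable P → ℕ
count P? = sum (indicator ∘ P?)

∑-mono-≤ : ∀ {n} {f g : Fin n → ℕ} → (∀ i → f i ≤ g i) → sum f ≤ sum g
∑-mono-≤ {zero}  _   = z≤n
∑-mono-≤ {suc n} f≤g = +-mono-≤ (f≤g zero) (∑-mono-≤ (f≤g ∘ suc))

module _ {n : ℕ} {P Q : Pred (Fin n) 0ℓ} where

  count-mono : (P? : Decidable P) (Q? : Decidable Q) → P ⊆ₚ Q → count P? ≤ count Q?
  count-mono P? Q? P⊆Q = ∑-mono-≤ λ i → indicator-mono (P? i) (Q? i) P⊆Q

  count-∪ : (P? : Decidable P) (Q? : Decidable Q) → P ⊥ Q → count (P? ∪? Q?) ≡ count P? + count Q?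
  count-∪ P? Q? P⊥Q = trans (sum-cong-≗ pointwise) (∑-distrib-+ (indicator ∘ P?) (indicator ∘ Q?))
    where
    pointwise : ∀ i → indicator ((P? ∪? Q?) i) ≡ indicator (P? i) + indicator (Q? i)
    pointwise i with P? i | Q? i
    ... | yes p | yes q = contradiction (p , q) P⊥Q
    ... | yes _ | no _  = refl
    ... | no _  | yes _ = refl
    ... | no _  | no _  = refl

count-∅ : ∀ {n} {P : Pred (Fin n) 0ℓ} (P? : Decidable P) → (∀ i → ¬ P i) → count P? ≡ 0
count-∅ {zero}  P? _ = refl
count-∅ {suc n} P? ∄P with P? zero
... | yes p = contradiction p (∄P zero)
... | no _  = count-∅ (P? ∘ suc) (∄P ∘ suc)

count-universal : ∀ {n} {P : Pred (Fin n) 0ℓ} (P? : Decidable P) → (∀ i → P i) → count P? ≡ n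
count-universal {zero}  P? _ = refl
count-universal {suc n} P? ∀P with P? zero
... | yes _ = cong suc (count-universal (P? ∘ suc) (∀P ∘ suc))
... | no ¬p = contradiction (∀P zero) ¬p

count>0 : ∀ {n} {P : Pred (Fin n) 0ℓ} (P? : Decidable P) {i : Fin n} → P i → 0 < count P?
count>0 P? {zero} p with P? zero
... | yes _ = s≤s z≤n
... | no ¬p = contradiction p ¬p
count>0 P? {suc i} p = ≤-trans (count>0 (P? ∘ suc) p) (m≤n+m _ (indicator (P? zero)))

module _ {n : ℕ} {P : Pred (Fin n) 0ℓ} where

  count-∁ : (P? : Decidable P) → count P? + count (∁? P?) ≡ n
  count-∁ P? = trans (sym (count-∪ P? (∁? P?) λ (p , ¬p) → ¬p p))
                     (count-universal (P? ∪? ∁? P?) (toSum ∘ P?))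

  count>0⇒satisfiable : (P? : Decidable P) → 0 < count P? → Satisfiable P
  count>0⇒satisfiable P? count>0 with any? P?
  ... | yes s = s
  ... | no ∄P = contradiction (count-∅ P? λ i p → ∄P (i , p)) (>⇒≢ count>0)

  count-insert : (P? : Decidable P) {i : Fin n} → ¬ P i → suc (count P?) ≤ count ((i ≟_) ∪? P?)
  count-insert P? {i} i∉P =
    subst (suc (count P?) ≤_) (sym (count-∪ (i ≟_) P? λ { (refl , i∈P) → i∉P i∈P }))
          (+-monoˡ-≤ (count P?) (count>0 (i ≟_) refl))

  *-count-≤-∑ : (P? : Decidable P) {f : Fin n → ℕ} {c : ℕ} →
                (∀ {i} → P i → c ≤ f i) → c * count P? ≤ sum f
  *-count-≤-∑ P? {f} {c} lower =
    subst (_≤ sum f) (sym (*-distribˡ-sum c (indicator ∘ P?))) (∑-mono-≤ pointwise)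
    where
    pointwise : ∀ i → c * indicator (P? i) ≤ f i
    pointwise i with P? i
    ... | yes p = subst (_≤ f i) (sym (*-identityʳ c)) (lower p)
    ... | no _  = subst (_≤ f i) (sym (*-zeroʳ c)) z≤n

  ∑-≤-*-count : (P? : Decidable P) {f : Fin n → ℕ} {c : ℕ} →
                (∀ {i} → P i → f i ≤ c) → (∀ {i} → ¬ P i → f i ≡ 0) → sum f ≤ c * count P?
  ∑-≤-*-count P? {f} {c} upper outside =
    subst (sum f ≤_) (sym (*-distribˡ-sum c (indicator ∘ P?))) (∑-mono-≤ pointwise)
    where
    pointwise : ∀ i → f i ≤ c * indicator (P? i)
    pointwise i with P? i
    ... | yes p = subst (f i ≤_) (sym (*-identityʳ c)) (upper p)
    ... | no ¬p = subst (_≤ c * 0) (sym (outside ¬p)) z≤n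

data Walk {A : Set} (R : Rel A 0ℓ) : ℕ → Rel A 0ℓ where
  []  : ∀ {x} → Walk R 0 x x
  _∷_ : ∀ {x y z m} → R x y → Walk R m y z → Walk R (suc m) x z

module _ {A : Set} {R : Rel A 0ℓ} where

  _++_ : ∀ {x y z l m} → Walk R l x y → Walk R m y z → Walk R (l + m) x z
  []      ++ W = W
  (e ∷ V) ++ W = e ∷ (V ++ W)

  -- Positions past the end of the walk all denote its last vertex.
  vertexAt : ∀ {x z m} → Walk R m x z → ℕ → A
  vertexAt {x} []      _       = x
  vertexAt {x} (_ ∷ _) zero    = x
  vertexAt     (_ ∷ W) (suc p) = vertexAt W p

  walk-increasing : ∀ {B : Set} {_≺_ : Rel B 0ℓ} {P : Pred A 0ℓ} (f : A → B) → Transitive _≺_ →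
                    (∀ {a b} → R a b → P a → P b → f a ≺ f b) →
                    ∀ {x z m} (W : Walk R (suc m) x z) →
                    (∀ p → p < suc m → P (vertexAt W p)) → P z → f x ≺ f z
  walk-increasing f ≺-trans arc-≺ (e ∷ []) onW Pz = arc-≺ e (onW 0 (s≤s z≤n)) Pz
  walk-increasing {_≺_ = _≺_} {P} f ≺-trans arc-≺ (e ∷ W@(_ ∷ _)) onW Pz =
    ≺-trans (arc-≺ e (onW 0 (s≤s z≤n)) (onW 1 (s≤s (s≤s z≤n))))
            (walk-increasing {_≺_ = _≺_} {P} f ≺-trans arc-≺ W (λ p p≤m → onW (suc p) (s≤s p≤m)) Pz)

-- The vertices form a decidable subset of Fin n, so that vertices can be deleted without
-- renumbering; only edges into a vertex count as arcs.  Girth is phrased with closed walks,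
-- which for a lower bound on the girth is the same as with cycles.
record Digraph (n : ℕ) : Set₁ where
  field
    Vertex  : Pred (Fin n) 0ℓ
    vertex? : Decidable Vertex
    Edge    : Rel (Fin n) 0ℓ
    edge?   : Decidable₂ Edge

  Arc : Rel (Fin n) 0ℓ
  Arc u a = Vertex a × Edge u a

  arc? : Decidable₂ Arc
  arc? u a = vertex? a ×-dec edge? u a

  In : Fin n → Pred (Fin n) 0ℓ
  In v u = Vertex u × Arc u v

  in? : ∀ v → Decidable (In v)
  in? v u = vertex? u ×-dec arc? u v

  order : ℕ
  order = count vertex?

  outdeg : Fin n → ℕ
  outdeg u = count (arc? u)

  indeg : Fin n → ℕ
  indeg v = count (in? v)

  MinOutDegree : ℕ → Set
  MinOutDegree r = ∀ {u} → Vertex u → r ≤ outdeg u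

  GirthExceeds : ℕ → Set
  GirthExceeds g = ∀ {x m} → 0 < m → m ≤ g → ¬ Walk Arc m x x

  loopless : ∀ {g} → 0 < g → GirthExceeds g → ∀ {u} → ¬ Arc u u
  loopless 0<g girth u→u = girth (s≤s z≤n) 0<g (u→u ∷ [])

  ∃-indeg≥ : ∀ {r} → Satisfiable Vertex → MinOutDegree r → ∃ λ v → Vertex v × r ≤ indeg v
  ∃-indeg≥ {zero}  (v , v∈V) _ = v , v∈V , z≤n
  ∃-indeg≥ {suc r} (v , v∈V) δ with any? (λ v → vertex? v ×-dec (suc r ≤? indeg v))
  ... | yes found = found
  ... | no none   = contradiction (≤-trans lower upper)
                                  (<⇒≱ (*-monoˡ-< order {{>-nonZero (count>0 vertex? v∈V)}} (n<1+n r)))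
    where
    arcs : ℕ
    arcs = sum (λ u → count (λ a → in? a u))
    lower : suc r * order ≤ arcs
    lower = *-count-≤-∑ vertex? λ u∈V →
      ≤-trans (δ u∈V) (count-mono (arc? _) (λ a → in? a _) (u∈V ,_))
    upper : arcs ≤ r * order
    upper = subst (_≤ r * order) (sym (∑-comm (λ u a → indicator (in? a u))))
      (∑-≤-*-count vertex? {c = r} (λ a∈V → s≤s⁻¹ (≰⇒> λ r<indeg → none (_ , a∈V , r<indeg)))
                                   (λ a∉V → count-∅ (in? _) λ u u→a → a∉V (proj₁ (proj₂ u→a))))

-- The Chvátal–Szemerédi step: delete v together with its in-neighbours, and let every vertex
-- with an edge into the deleted set S inherit the out-arcs of v.  A new arc u → a stands for a
-- walk u → S → v → a of length at most 3, so a closed walk of the contracted digraph gives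
-- one of G through v that is longer by at most 2.
module Contraction {n} (G : Digraph n) (v : Fin n) (v∈V : Digraph.Vertex G v)
                   (girth₂ : Digraph.GirthExceeds G 2) where
  open Digraph G

  S : Pred (Fin n) 0ℓ
  S = ｛ v ｝ ∪ In v

  s? : Decidable S
  s? = (v ≟_) ∪? in? v

  EntersS : Pred (Fin n) 0ℓ
  EntersS u = ∃ λ y → S y × Edge u y

  entersS? : Decidable EntersS
  entersS? u = any? λ y → s? y ×-dec edge? u y

  contracted : Digraph n
  contracted = record
    { Vertex  = Vertex ∩ ∁ S
    ; vertex? = vertex? ∩? ∁? s?
    ; Edge    = λ u a → Edge u a ⊎ (EntersS u × Edge v a)
    ; edge?   = λ u a → edge? u a ⊎-dec (entersS? u ×-dec edge? v a)
    }

  module Contracted = Digraph contracted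

  S⊆V : S ⊆ₚ Vertex
  S⊆V (inj₁ refl)      = v∈V
  S⊆V (inj₂ (a∈V , _)) = a∈V

  out-v-survives : Arc v ⊆ₚ Contracted.Vertex
  out-v-survives v→a@(a∈V , _) = a∈V , λ
    { (inj₁ refl)      → loopless (s≤s z≤n) girth₂ v→a
    ; (inj₂ (_ , a→v)) → girth₂ (s≤s z≤n) ≤-refl (v→a ∷ (a→v ∷ []))
    }

  S-large : suc (indeg v) ≤ count s?
  S-large = count-insert (in? v) λ (_ , v→v) → loopless (s≤s z≤n) girth₂ v→v

  contracted-order : Contracted.order + count s? ≤ order
  contracted-order = subst (_≤ order) (count-∪ Contracted.vertex? s? λ ((_ , a∉S) , a∈S) → a∉S a∈S)
    (count-mono (Contracted.vertex? ∪? s?) vertex? λ { (inj₁ (a∈V , _)) → a∈V ; (inj₂ a∈S) → S⊆V a∈S })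

  outdeg≤contracted-order : outdeg v ≤ Contracted.order
  outdeg≤contracted-order = count-mono (arc? v) Contracted.vertex? out-v-survives

  keeps-out-arcs : ∀ u → (Arc v ⊆ₚ Contracted.Arc u) ⊎ (Arc u ⊆ₚ Contracted.Arc u)
  keeps-out-arcs u with entersS? u
  ... | yes enters = inj₁ λ v→a → out-v-survives v→a , inj₂ (enters , proj₂ v→a)
  ... | no avoids  = inj₂ λ (a∈V , u→a) → (a∈V , λ a∈S → avoids (_ , a∈S , u→a)) , inj₁ u→a

  contracted-minOutDegree : ∀ {r} → MinOutDegree r → Contracted.MinOutDegree r
  contracted-minOutDegree δ {u} (u∈V , _) with keeps-out-arcs u
  ... | inj₁ v-arcs = ≤-trans (δ v∈V) (count-mono (arc? v) (Contracted.arc? u) v-arcs)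
  ... | inj₂ u-arcs = ≤-trans (δ u∈V) (count-mono (arc? u) (Contracted.arc? u) u-arcs)

  enter-v : ∀ {u} → EntersS u → ∃ λ q → q ≤ 1 × Walk Arc (suc q) u v
  enter-v (_ , inj₁ refl , u→v)        = 0 , z≤n , (v∈V , u→v) ∷ []
  enter-v (_ , inj₂ (y∈V , y→v) , u→y) = 1 , ≤-refl , (y∈V , u→y) ∷ (y→v ∷ [])

  record Detour (m : ℕ) (x z : Fin n) : Set where
    constructor detour
    field
      m₁ m₂ : ℕ
      toV   : Walk Arc (suc m₁) x v
      fromV : Walk Arc m₂ v z
      short : suc m₁ + m₂ ≤ 2 + m

  lift : ∀ {x z m} → Walk Contracted.Arc m x z → Walk Arc m x z ⊎ Detour m x z
  lift [] = inj₁ []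
  lift (((a∈V , _) , inj₁ e) ∷ W) with lift W
  ... | inj₁ W₀ = inj₁ ((a∈V , e) ∷ W₀)
  ... | inj₂ (detour m₁ m₂ toV fromV short) =
    inj₂ (detour (suc m₁) m₂ ((a∈V , e) ∷ toV) fromV (s≤s short))
  lift {m = suc m} (((a∈V , _) , inj₂ (enters , e)) ∷ W) with enter-v enters | lift W
  ... | q , q≤1 , toV | inj₁ W₀ =
    inj₂ (detour q (suc m) toV ((a∈V , e) ∷ W₀) (+-monoˡ-≤ (suc m) (s≤s q≤1)))
  ... | q , q≤1 , toV | inj₂ (detour m₁ m₂ _ fromV short) =
    inj₂ (detour q m₂ toV fromV (+-mono-≤ (s≤s q≤1) (≤-trans (m≤n+m m₂ m₁) (s≤s⁻¹ short))))

  contracted-girth : ∀ {g} → GirthExceeds (2 + g) → Contracted.GirthExceeds g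
  contracted-girth {g} girth 0<m m≤g W with lift W
  ... | inj₁ W₀ = girth 0<m (≤-trans m≤g (m≤n+m g 2)) W₀
  ... | inj₂ (detour m₁ m₂ toV fromV short) =
    girth (s≤s z≤n) (≤-trans short (+-monoʳ-≤ 2 m≤g))
          (subst (λ l → Walk Arc l v v) (+-comm m₂ (suc m₁)) (fromV ++ toV))

open Digraph

chvátal-szemerédi : ∀ {n} g (G : Digraph n) {r} → 0 < r → Satisfiable (Vertex G) →
                    MinOutDegree G r → GirthExceeds G g → suc r * suc g ≤ 2 * order G
chvátal-szemerédi zero G {r} r>0 (u , u∈V) δ _ = begin
  suc r * 1         ≡⟨ *-identityʳ (suc r) ⟩
  suc r             ≤⟨ +-monoˡ-≤ r r>0 ⟩
  r + r             ≤⟨ +-mono-≤ r≤order r≤order ⟩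
  order G + order G ≡⟨ cong (order G +_) (+-identityʳ (order G)) ⟨
  2 * order G       ∎
  where
  open ≤-Reasoning
  r≤order : r ≤ order G
  r≤order = ≤-trans (δ u∈V) (count-mono (arc? G u) (vertex? G) proj₁)
chvátal-szemerédi (suc zero) G {r} _ (u , u∈V) δ girth =
  subst (_≤ 2 * order G) (*-comm 2 (suc r)) (*-monoʳ-≤ 2 r<order)
  where
  open ≤-Reasoning
  r<order : suc r ≤ order G
  r<order = begin
    suc r                      ≤⟨ s≤s (δ u∈V) ⟩
    suc (outdeg G u)           ≤⟨ count-insert (arc? G u) (loopless G (s≤s z≤n) girth) ⟩
    count ((u ≟_) ∪? arc? G u) ≤⟨ count-mono ((u ≟_) ∪? arc? G u) (vertex? G)
                                    (λ { (inj₁ refl) → u∈V ; (inj₂ (a∈V , _)) → a∈V }) ⟩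
    order G                    ∎
chvátal-szemerédi (suc (suc g)) G {r} r>0 nonempty δ girth with ∃-indeg≥ G nonempty δ
... | v , v∈V , r≤indeg = begin
  suc r * (3 + g)                     ≡⟨ split-off-2 r g ⟩
  suc r * suc g + 2 * suc r           ≤⟨ +-mono-≤ ih (*-monoʳ-≤ 2 (≤-trans (s≤s r≤indeg) S-large)) ⟩
  2 * order contracted + 2 * count s? ≡⟨ *-distribˡ-+ 2 (order contracted) (count s?) ⟨
  2 * (order contracted + count s?)   ≤⟨ *-monoʳ-≤ 2 contracted-order ⟩
  2 * order G                         ∎
  where
  open ≤-Reasoning
  split-off-2 : ∀ r g → suc r * (3 + g) ≡ suc r * suc g + 2 * suc r
  split-off-2 = solve-∀
  girth₂ : GirthExceeds G 2
  girth₂ 0<m m≤2 = girth 0<m (≤-trans m≤2 (m≤m+n 2 g))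
  open Contraction G v v∈V girth₂
  ih : suc r * suc g ≤ 2 * order contracted
  ih = chvátal-szemerédi g contracted r>0
    (count>0⇒satisfiable (vertex? contracted) (≤-trans r>0 (≤-trans (δ v∈V) outdeg≤contracted-order)))
    (contracted-minOutDegree δ) (contracted-girth girth)

large-share : ∀ k c d → (0 < d → suc d * suc k ≤ 2 * (c + d)) → (k ∸ 1) * (c + d) ≤ suc k * c
large-share zero    c d        _ = z≤n
large-share (suc j) c zero     _ =
  subst (λ x → j * x ≤ suc (suc j) * c) (sym (+-identityʳ c)) (*-monoˡ-≤ c (m≤n+m j 2))
large-share (suc j) c d@(suc _) few = begin
  j * (c + d)     ≡⟨ *-distribˡ-+ j c d ⟩
  j * c + j * d   ≤⟨ +-monoʳ-≤ (j * c) jd≤2c ⟩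
  j * c + 2 * c   ≡⟨ *-distribʳ-+ c j 2 ⟨
  (j + 2) * c     ≡⟨ cong (_* c) (+-comm j 2) ⟩
  suc (suc j) * c ∎
  where
  open ≤-Reasoning
  expand : ∀ j d → suc d * suc (suc j) ≡ (j * d + 2 * d) + (2 + j)
  expand = solve-∀
  jd≤2c : j * d ≤ 2 * c
  jd≤2c = +-cancelʳ-≤ (2 * d) (j * d) (2 * c) (begin
    j * d + 2 * d             ≤⟨ m≤m+n (j * d + 2 * d) (2 + j) ⟩
    (j * d + 2 * d) + (2 + j) ≡⟨ expand j d ⟨
    suc d * suc (suc j)       ≤⟨ few (s≤s z≤n) ⟩
    2 * (c + d)               ≡⟨ *-distribˡ-+ 2 c d ⟩
    2 * c + 2 * d             ∎)

length-filter≡count : ∀ {A : Set} {P : Pred A 0ℓ} (P? : Decidable P) (xs : List A) →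
                      length (filter P? xs) ≡ count (P? ∘ List.lookup xs)
length-filter≡count P? []       = refl
length-filter≡count P? (x ∷ xs) with P? x
... | yes _ = cong suc (length-filter≡count P? xs)
... | no _  = length-filter≡count P? xs

module _ {t : ℕ} where

  leftEnd : TInterval t → Fin t → ℚ
  leftEnd h l = proj₁ (lookup h l)

  LeftEndIn : Rel (TInterval t) 0ℓ
  LeftEndIn h₀ h = ∃ λ l → leftEnd h₀ l ∈I lookup h l

  leftEndIn? : Decidable₂ LeftEndIn
  leftEndIn? h₀ h = any? λ l →
    (proj₁ (lookup h l) ℚ.≤? leftEnd h₀ l) ×-dec (leftEnd h₀ l ℚ.≤? proj₂ (lookup h l))

  filter-leftEndIn-weaklyIntersecting : ∀ h₀ (H : List (TInterval t)) →
                                        WeaklyIntersecting (filter (leftEndIn? h₀) H)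
  filter-leftEndIn-weaklyIntersecting h₀ H = just ∘ leftEnd h₀ , λ h h∈F →
    let l , end∈h = proj₂ (∈-filter⁻ (leftEndIn? h₀) {xs = H} h∈F) in l , leftEnd h₀ l , refl , end∈h

  leftEnd-< : ∀ h₀ h {l y} → ¬ LeftEndIn h₀ h → y ∈I lookup h₀ l → y ∈I lookup h l →
              leftEnd h₀ l ℚ.< leftEnd h l
  leftEnd-< h₀ h {l} ∉h (lo₀≤y , _) (_ , y≤hi) =
    ℚ.≰⇒> λ lo≤lo₀ → ∉h (l , lo≤lo₀ , ℚ.≤-trans lo₀≤y y≤hi)

  module _ (H : List (TInterval t)) where

    leftEndGraph : Digraph (length H)
    leftEndGraph = record
      { Vertex  = U
      ; vertex? = λ _ → yes tt
      ; Edge    = λ i j → ¬ LeftEndIn (List.lookup H i) (List.lookup H j)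
      ; edge?   = λ i j → ¬? (leftEndIn? (List.lookup H i) (List.lookup H j))
      }

    leftEndGraph-girth : ∀ {k} → KWiseIntersecting k H → GirthExceeds leftEndGraph k
    leftEndGraph-girth {k} kWise {m = suc m} _ m≤k W@(_ ∷ _) = ℚ.<-irrefl refl
      (walk-increasing {_≺_ = ℚ._<_} {P = Contains} (λ i → leftEnd (List.lookup H i) l) ℚ.<-trans
                       (λ {i} {j} (_ , ∉j) → leftEnd-< (List.lookup H i) (List.lookup H j) ∉j)
                       W onWalk (onWalk 0 (s≤s z≤n)))
      where
      position : Fin k → Fin (length H)
      position j = vertexAt W (toℕ j)
      common : ∃ λ (p : Point t) → ∀ j → p ∈T List.lookup H (position j)
      common = kWise (List.lookup H ∘ position) (∈-lookup ∘ position)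
      l : Fin t
      l = proj₁ (proj₁ common)
      y : ℚ
      y = proj₂ (proj₁ common)
      Contains : Pred (Fin (length H)) 0ℓ
      Contains i = y ∈I lookup (List.lookup H i) l
      onWalk : ∀ p → p < suc m → Contains (vertexAt W p)
      onWalk p p≤m = subst (Contains ∘ vertexAt W) (toℕ-fromℕ< p<k) (proj₂ common (fromℕ< p<k))
        where
        p<k : p < k
        p<k = ≤-trans p≤m m≤k

    ∃-popular-leftEnds : ∀ {k} → Fin (length H) → KWiseIntersecting k H →
                         ∃ λ h₀ → (k ∸ 1) * length H ≤ suc k * length (filter (leftEndIn? h₀) H)
    ∃-popular-leftEnds {k} i kWise = h₀ ,
      subst₂ (λ n c → (k ∸ 1) * n ≤ suc k * c) partition (sym (length-filter≡count (leftEndIn? h₀) H))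
             (large-share k (count containsLeftEnd?) d few-arcs)
      where
      u : Fin (length H)
      u = argmin (outdeg leftEndGraph) i (allFin (length H))
      minimal : MinOutDegree leftEndGraph (outdeg leftEndGraph u)
      minimal {w} _ = All.lookup (f[argmin]≤f[xs] {f = outdeg leftEndGraph} i (allFin _)) (∈-allFin w)
      h₀ : TInterval t
      h₀ = List.lookup H u
      containsLeftEnd? : Decidable (LeftEndIn h₀ ∘ List.lookup H)
      containsLeftEnd? = leftEndIn? h₀ ∘ List.lookup H
      d : ℕ
      d = outdeg leftEndGraph u
      -- d is count (∁? containsLeftEnd?) up to `true ∧_`, which `indicator` computes through.
      partition : count containsLeftEnd? + d ≡ length H
      partition = count-∁ containsLeftEnd?
      few-arcs : 0 < d → suc d * suc k ≤ 2 * (count containsLeftEnd? + d)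
      few-arcs d>0 = subst (λ n → suc d * suc k ≤ 2 * n)
                           (trans (count-universal (vertex? leftEndGraph) _) (sym partition))
                           (chvátal-szemerédi k leftEndGraph d>0 (u , tt) minimal (leftEndGraph-girth kWise))

theorem1p2 : (t k : ℕ) → 1 ≤ t → 2 ≤ k →
    (H : List (TInterval t)) → Unique H → All WellFormed H →
    KWiseIntersecting k H →
    ∃ (λ (F : List (TInterval t)) →
    F ⊆ H × (k ∸ 1) * length H ≤ suc k * length F × WeaklyIntersecting F)
theorem1p2 t k _ _ [] _ _ _ =
  [] , [] , ≤-reflexive (trans (*-zeroʳ (k ∸ 1)) (sym (*-zeroʳ (suc k)))) , (λ _ → nothing) , λ _ ()
theorem1p2 t k _ _ H@(_ ∷ _) _ _ kWise =
  let h₀ , bound = ∃-popular-leftEnds H zero kWise in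
  filter (leftEndIn? h₀) H , filter-⊆ (leftEndIn? h₀) H , bound , filter-leftEndIn-weaklyIntersecting h₀ H
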